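{- Let $G$ be a finite simple graph. For each vertex $v \in V(G)$ let $p(v)$ denote the maximum number $r$ such that $v$ lies on a path of $G$ with $r$ edges. Then \[ |E(G)| \le \sum_{v \in V(G)} \frac{p(v)}{2}, \] and equality holds if and only if every connected component of $G$ is a clique (complete graph).
   Context: A path with $r$ edges (length $r$) is a sequence of $r+1$ distinct vertices with consecutive ones adjacent; a single vertex is a path with $0$ edges, so an isolated vertex $v$ has $p(v)=0$. -}

module Defs where

open import Data.Nat using (ℕ; zero; suc; _+_; _∸_; _≤_)
open import Data.Nat.Base using (_<ᵇ_)
open import Data.Bool using (Bool; true; false; if_then_else_; _∧_; T)
open import Data.Fin using (Fin; toℕ)
open import Data.Fin as F using ()
open import Data.List using (List; length)
open import Data.List.Relation.Unary.Unique.Propositional using (Unique)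
open import Data.List.Relation.Unary.Linked using (Linked)
open import Data.List.Membership.Propositional using (_∈_)
open import Data.Product using (Σ; _×_)
open import Relation.Binary.PropositionalEquality using (_≡_; _≢_)

record Graph (n : ℕ) : Set where
  field
    adj    : Fin n → Fin n → Bool
    sym    : ∀ i j → adj i j ≡ adj j i
    irrefl : ∀ i → adj i i ≡ false
open Graph public

Adj : ∀ {n} → Graph n → Fin n → Fin n → Set
Adj G u v = T (adj G u v)

sumFin : ∀ {n} → (Fin n → ℕ) → ℕ
sumFin {zero}  f = 0
sumFin {suc n} f = f F.zero + sumFin (λ i → f (F.suc i))

edgeCount : ∀ {n} → Graph n → ℕ
edgeCount G = sumFin (λ i → sumFin (λ j →
  if (toℕ i <ᵇ toℕ j) ∧ adj G i j then 1 else 0))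

-- A path: a (nonempty when it contains a vertex) list of distinct vertices
-- with consecutive ones adjacent.  Its number of edges is length ∸ 1.
IsPath : ∀ {n} → Graph n → List (Fin n) → Set
IsPath G xs = Unique xs × Linked (Adj G) xs

IsMaxPathLen : ∀ {n} → Graph n → Fin n → ℕ → Set
IsMaxPathLen G v r =
  Σ (List _) (λ xs → IsPath G xs × v ∈ xs × length xs ≡ suc r)
  × (∀ xs → IsPath G xs → v ∈ xs → length xs ≤ suc r)

data Reachable {n} (G : Graph n) : Fin n → Fin n → Set where
  here : ∀ {u} → Reachable G u u
  step : ∀ {u v w} → Adj G u v → Reachable G v w → Reachable G u w

ComponentsAreCliques : ∀ {n} → Graph n → Set
ComponentsAreCliques G = ∀ u v → Reachable G u v → u ≢ v → Adj G u v

{-# OPTIONS --safe #-}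

-- Strengthen to: for every vertex set S and every p such that each path of G[S] through u has
-- at most p u edges, ∑_{u ∈ S} deg_S u ≤ ∑_{u ∈ S} p u, with equality only if G[S] is a cluster
-- graph (adjacency is transitive on distinct vertices, i.e. every component is a clique).
-- Grow a path P of G[S] at its ends until both ends x and z have all their neighbours on P.
-- If no vertex of P has a neighbour off P, then P spans a component C, where deg u ≤ |C| - 1 ≤ p u;
-- remove C. If an end v has 2 deg v ≤ p v, remove v, which lowers the left side by 2 deg v and
-- the right side by p v; in the tight case S - v is a cluster graph, in which the other end e of P
-- only lies on paths inside P - v, so p e ≥ |P| - 1 is not the least bound at e, contradicting
-- tightness for S - v. Otherwise deg x + deg z ≥ |P|, so by Ore's argument V(P) spans a cycle,
-- and a neighbour off the cycle gives a longer path; this terminates since paths have ≤ n vertices.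

module Submission where

open import Defs renaming (sym to adj-sym; irrefl to adj-irrefl)
open import Level using (Level)
open import Data.Bool using (Bool; true; false; T; _∧_; not; if_then_else_)
open import Data.Bool.Properties using (T?)
open import Data.Unit using (tt)
open import Data.Nat using (ℕ; zero; suc; _+_; _*_; _≤_; _<_; _<ᵇ_; z≤n; s≤s; s≤s⁻¹)
open import Data.Nat.Properties
open import Data.Fin using (Fin; zero; suc; punchIn; toℕ)
import Data.Fin.Properties as Fin
open import Data.Vec.Functional using (updateAt)
open import Data.Vec.Functional.Properties using (updateAt-updates; updateAt-minimal)
open import Algebra.Properties.CommutativeMonoid.Sum +-0-commutativeMonoid
  using (sum; sum-cong-≗; sum-remove; sum-replicate-zero)
  renaming (∑-distrib-+ to sum-distrib-+; ∑-comm to sum-comm)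
open import Data.List using (List; []; _∷_; _++_; _ʳ++_; [_]; length; filter; filterᵇ; tabulate; allFin)
open import Data.List.Properties using (length-++; length-tabulate; filter-notAll; filter-reject)
open import Data.List.Membership.Propositional using (_∈_; _∉_; find; lose)
open import Data.List.Membership.Propositional.Properties using (∈-filter⁺; ∈-filter⁻; ∈-allFin; ∈-++⁻; ∈-∃++)
import Data.List.Membership.DecPropositional as DecMembership
open import Data.List.Relation.Unary.Any as Any using (here; there; any?)
open import Data.List.Relation.Unary.All as All using (All; []; _∷_)
open import Data.List.Relation.Unary.AllPairs using ([]; _∷_)
open import Data.List.Relation.Unary.Unique.Propositional using (Unique)
import Data.List.Relation.Unary.Unique.Propositional.Properties as Unique
open import Data.List.Relation.Unary.Linked as Linked using (Linked; []; [-]; _∷_)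
open import Data.List.Relation.Binary.Subset.Propositional using (_⊆_)
open import Data.List.Relation.Binary.Permutation.Propositional using (_↭_; ↭-refl; ↭-sym; ↭-trans; prep; ↭⇒↭ₛ)
open import Data.List.Relation.Binary.Permutation.Propositional.Properties
  using (++-comm; ++↭ʳ++; ∈-resp-↭; All-resp-↭; ↭-length; ∷↭∷ʳ)
import Data.List.Relation.Binary.Permutation.Setoid.Properties as Perm
open import Data.Product using (∃; ∃₂; _×_; _,_; proj₁; proj₂)
open import Data.Sum using (_⊎_; inj₁; inj₂)
open import Data.Empty using (⊥-elim)
open import Function using (_∘_)
open import Function.Bundles using (_⇔_; mk⇔)
open import Relation.Binary using (Rel; Symmetric; DecidableEquality)
open import Relation.Nullary using (¬_; yes; no; ¬?; contradiction)
open import Relation.Nullary.Decidable using (⌊_⌋; toWitness; fromWitness; _×-dec_)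
open import Relation.Nullary.Reflects using (ofʸ; ofⁿ)
open import Relation.Unary using (Pred; Decidable)
open import Relation.Binary.PropositionalEquality
  using (_≡_; _≢_; refl; sym; trans; cong; subst; subst₂; setoid; module ≡-Reasoning)

private
  variable
    a ℓ ℓ₁ ℓ₂ : Level
    A : Set a

m≤2a∧m≤2b⇒m≤a+b : ∀ {m a b} → m ≤ 2 * a → m ≤ 2 * b → m ≤ a + b
m≤2a∧m≤2b⇒m≤a+b {m} {a} {b} m≤2a m≤2b = *-cancelˡ-≤ 2 (begin
  2 * m           ≡⟨ cong (m +_) (+-identityʳ m) ⟩
  m + m           ≤⟨ +-mono-≤ m≤2a m≤2b ⟩
  2 * a + 2 * b   ≡⟨ *-distribˡ-+ 2 a b ⟨
  2 * (a + b)     ∎)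
  where open ≤-Reasoning

≤+≤-≡⇒≡ : ∀ {a b c d} → a ≤ b → c ≤ d → a + c ≡ b + d → a ≡ b × c ≡ d
≤+≤-≡⇒≡ {a} {b} {c} {d} a≤b c≤d eq = a≡b , +-cancelˡ-≡ a c d (trans eq (cong (_+ d) (sym a≡b)))
  where
  a≡b : a ≡ b
  a≡b = ≤-antisym a≤b (+-cancelʳ-≤ c b a (≤-trans (+-monoʳ-≤ b c≤d) (≤-reflexive (sym eq))))

-- Lists: paths, crossings and cycles

unique⊆⇒length≤ : DecidableEquality A → {xs ys : List A} → Unique xs → xs ⊆ ys → length xs ≤ length ys
unique⊆⇒length≤ _≟_ {[]}     _              _     = z≤n
unique⊆⇒length≤ _≟_ {x ∷ xs} {ys} (x∉xs ∷ u) xs⊆ys = begin-strict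
  length xs                         ≤⟨ unique⊆⇒length≤ _≟_ u xs⊆ys-x ⟩
  length (filter (¬? ∘ (x ≟_)) ys)  <⟨ filter-notAll (¬? ∘ (x ≟_)) ys x∈ys ⟩
  length ys                         ∎
  where
  open ≤-Reasoning
  x∈ys = Any.map (λ x≡y x≢y → x≢y x≡y) (xs⊆ys (here refl))
  xs⊆ys-x : xs ⊆ filter (¬? ∘ (x ≟_)) ys
  xs⊆ys-x y∈xs = ∈-filter⁺ (¬? ∘ (x ≟_)) (xs⊆ys (there y∈xs)) (All.lookup x∉xs y∈xs)

lastOf : A → List A → A
lastOf x []       = x
lastOf _ (y ∷ ys) = lastOf y ys

lastOf-∈ : (x : A) (xs : List A) → lastOf x xs ∈ x ∷ xs
lastOf-∈ x []       = here refl
lastOf-∈ x (y ∷ ys) = there (lastOf-∈ y ys)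

lastOf-++ : (x : A) (xs : List A) (y : A) (ys : List A) → lastOf x (xs ++ y ∷ ys) ≡ lastOf y ys
lastOf-++ x []       y ys = refl
lastOf-++ x (z ∷ xs) y ys = lastOf-++ z xs y ys

head≢lastOf : ∀ {x y : A} {ys} → Unique (x ∷ y ∷ ys) → x ≢ lastOf y ys
head≢lastOf {y = y} {ys} (x∉ ∷ _) = All.lookup x∉ (lastOf-∈ y ys)

module _ {R : Rel A ℓ} where

  Linked-++⁻ : ∀ xs {ys} → Linked R (xs ++ ys) → Linked R xs × Linked R ys
  Linked-++⁻ []           l        = [] , l
  Linked-++⁻ (x ∷ [])     [-]      = [-] , []
  Linked-++⁻ (x ∷ [])     (_ ∷ l)  = [-] , l
  Linked-++⁻ (x ∷ y ∷ xs) (r ∷ l) with Linked-++⁻ (y ∷ xs) l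
  ... | lxs , lys = r ∷ lxs , lys

  Linked-join : ∀ {x xs y ys} → Linked R (x ∷ xs) → R (lastOf x xs) y → Linked R (y ∷ ys) →
                Linked R (x ∷ xs ++ y ∷ ys)
  Linked-join [-]     r lys = r ∷ lys
  Linked-join (r′ ∷ l) r lys = r′ ∷ Linked-join l r lys

  Linked-ʳ++ : Symmetric R → ∀ {x xs ys} → Linked R (x ∷ xs) → Linked R (x ∷ ys) →
               Linked R (xs ʳ++ x ∷ ys)
  Linked-ʳ++ R-sym [-]     lys = lys
  Linked-ʳ++ R-sym (r ∷ l) lys = Linked-ʳ++ R-sym l (R-sym r ∷ lys)

  cycle-rotate : ∀ {h t c} → Linked R (h ∷ t) → R (lastOf h t) h → c ∈ h ∷ t →
                 ∃ λ r → Linked R (c ∷ r) × c ∷ r ↭ h ∷ t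
  cycle-rotate l close c∈ with ∈-∃++ c∈
  ... | []     , vs , refl = vs , l , ↭-refl
  ... | u ∷ us , vs , refl with Linked-++⁻ (u ∷ us) l
  ...   | lus , lvs = vs ++ u ∷ us
                    , Linked-join lvs (subst (λ z → R z u) (lastOf-++ u us _ vs) close) lus
                    , ++-comm (_ ∷ vs) (u ∷ us)

ʳ++-ends : (x : A) (xs ys : List A) →
           ∃ λ t → xs ʳ++ x ∷ ys ≡ lastOf x xs ∷ t × lastOf (lastOf x xs) t ≡ lastOf x ys
ʳ++-ends x []       ys = ys , refl , refl
ʳ++-ends x (y ∷ xs) ys = ʳ++-ends y xs (x ∷ ys)

-- A path x … m b … z with x ∼ b and m ∼ z closes up into the cycle m … x b … z m.
crossing⇒cycle : {R : Rel A ℓ} → Symmetric R → ∀ {x ms b bs} → Linked R (x ∷ ms ++ b ∷ bs) →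
                 R x b → R (lastOf x ms) (lastOf b bs) →
                 ∃₂ λ h t → Linked R (h ∷ t) × R (lastOf h t) h × h ∷ t ↭ x ∷ ms ++ b ∷ bs
crossing⇒cycle {R = R} R-sym {x} {ms} {b} {bs} l x∼b m∼z with Linked-++⁻ (x ∷ ms) l | ʳ++-ends x ms (b ∷ bs)
... | lxms , lbbs | t , eq , last≡ =
  lastOf x ms , t
  , subst (Linked R) eq (Linked-ʳ++ R-sym lxms (x∼b ∷ lbbs))
  , subst (λ z → R z (lastOf x ms)) (sym last≡) (R-sym m∼z)
  , subst (_↭ x ∷ ms ++ b ∷ bs) eq (↭-sym (++↭ʳ++ (x ∷ ms) (b ∷ bs)))

module _ {P : Pred A ℓ₁} {Q : Pred A ℓ₂} (P? : Decidable P) (Q? : Decidable Q) where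

  -- Pigeonhole behind Ore's theorem: unless Q xᵢ₋₁ and P xᵢ for some i, every index i ∈ [1, k]
  -- of x₀ … x_k is counted at most once, by P xᵢ or by Q xᵢ₋₁.
  crossing : ∀ w ws → ¬ Q (lastOf w ws) →
             (∃₂ λ ms b → ∃ λ bs → ws ≡ ms ++ b ∷ bs × Q (lastOf w ms) × P b)
             ⊎ length (filter P? ws) + length (filter Q? (w ∷ ws)) ≤ length ws
  crossing w [] ¬qw with Q? w
  ... | yes qw = ⊥-elim (¬qw qw)
  ... | no  _  = inj₂ z≤n
  crossing w (v ∷ vs) ¬qz with Q? w | P? v | crossing v vs ¬qz
  ... | yes qw | yes pv | _ = inj₁ ([] , v , vs , refl , qw , pv)
  ... | _      | _      | inj₁ (ms , b , bs , refl , qm , pb) = inj₁ (v ∷ ms , b , bs , refl , qm , pb)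
  ... | yes _  | no _   | inj₂ h = inj₂ (subst (_≤ suc (length vs)) (sym (+-suc _ _)) (s≤s h))
  ... | no _   | yes _  | inj₂ h = inj₂ (s≤s h)
  ... | no _   | no _   | inj₂ h = inj₂ (m≤n⇒m≤1+n h)

-- Sums over vertex sets

sumFin≡sum : ∀ {n} (f : Fin n → ℕ) → sumFin f ≡ sum f
sumFin≡sum {zero}  f = refl
sumFin≡sum {suc n} f = cong (f zero +_) (sumFin≡sum (f ∘ suc))

sum-mono-≤ : ∀ {n} {f g : Fin n → ℕ} → (∀ i → f i ≤ g i) → sum f ≤ sum g
sum-mono-≤ {zero}  _   = z≤n
sum-mono-≤ {suc n} f≤g = +-mono-≤ (f≤g zero) (sum-mono-≤ (f≤g ∘ suc))

sum-mono-< : ∀ {n} {f g : Fin n → ℕ} → (∀ i → f i ≤ g i) → ∀ k → f k < g k → sum f < sum g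
sum-mono-< f≤g zero    fk<gk = +-mono-<-≤ fk<gk (sum-mono-≤ (f≤g ∘ suc))
sum-mono-< f≤g (suc k) fk<gk = +-mono-≤-< (f≤g zero) (sum-mono-< (f≤g ∘ suc) k fk<gk)

sum-zero : ∀ {n} {f : Fin n → ℕ} → (∀ i → f i ≡ 0) → sum f ≡ 0
sum-zero {n} f≡0 = trans (sum-cong-≗ f≡0) (sum-replicate-zero n)

𝟙 : Bool → ℕ
𝟙 b = if b then 1 else 0

𝟙-false : ∀ {b} → ¬ T b → 𝟙 b ≡ 0
𝟙-false {true}  ¬b = contradiction tt ¬b
𝟙-false {false} _  = refl

length-filterᵇ-tabulate : ∀ {m} (P : A → Bool) (f : Fin m → A) →
                          length (filterᵇ P (tabulate f)) ≡ sum (𝟙 ∘ P ∘ f)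
length-filterᵇ-tabulate {m = zero}  P f = refl
length-filterᵇ-tabulate {m = suc m} P f with P (f zero)
... | true  = cong suc (length-filterᵇ-tabulate P (f ∘ suc))
... | false = length-filterᵇ-tabulate P (f ∘ suc)

sum-single : ∀ {n} (f : Fin n → ℕ) v → (∀ u → u ≢ v → f u ≡ 0) → sum f ≡ f v
sum-single {suc n} f v f≡0 = begin
  sum f                           ≡⟨ sum-remove {i = v} f ⟩
  f v + sum (f ∘ punchIn v)       ≡⟨ cong (f v +_) (sum-zero (λ j → f≡0 (punchIn v j) (Fin.punchInᵢ≢i v j))) ⟩
  f v + 0                         ≡⟨ +-identityʳ (f v) ⟩
  f v                             ∎
  where open ≡-Reasoning

VertexSet : ℕ → Set
VertexSet n = Fin n → Bool

module _ {n : ℕ} where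

  open DecMembership (Fin._≟_ {n}) using (_∈?_)

  infix 4 _∈ₛ_ _∉ₛ_
  infixr 7 _∩_
  infixl 6 _∖_ _-_

  _∈ₛ_ : Fin n → VertexSet n → Set
  u ∈ₛ S = T (S u)

  _∉ₛ_ : Fin n → VertexSet n → Set
  u ∉ₛ S = ¬ u ∈ₛ S

  _∩_ _∖_ : VertexSet n → VertexSet n → VertexSet n
  (S ∩ C) u = S u ∧ C u
  (S ∖ C) u = S u ∧ not (C u)

  all : VertexSet n
  all _ = true

  ⁅_⁆ : Fin n → VertexSet n
  ⁅ v ⁆ u = ⌊ u Fin.≟ v ⌋

  _-_ : VertexSet n → Fin n → VertexSet n
  S - v = S ∖ ⁅ v ⁆

  setOf : List (Fin n) → VertexSet n
  setOf P u = ⌊ u ∈? P ⌋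

  ∈-∩⁻ : ∀ S C {u} → u ∈ₛ S ∩ C → u ∈ₛ S × u ∈ₛ C
  ∈-∩⁻ S C {u} with S u | C u
  ... | true | true = λ _ → tt , tt

  ∈-∩⁺ : ∀ S C {u} → u ∈ₛ S → u ∈ₛ C → u ∈ₛ S ∩ C
  ∈-∩⁺ S C {u} with S u | C u
  ... | true | true = λ _ _ → tt

  ∈-∖⁺ : ∀ S C {u} → u ∈ₛ S → u ∉ₛ C → u ∈ₛ S ∖ C
  ∈-∖⁺ S C {u} with S u | C u
  ... | true  | false = λ _ _ → tt
  ... | true  | true  = λ _ u∉C → ⊥-elim (u∉C tt)

  ∈-∖⁻ : ∀ S C {u} → u ∈ₛ S ∖ C → u ∈ₛ S × u ∉ₛ C
  ∈-∖⁻ S C {u} with S u | C u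
  ... | true  | false = λ _ → tt , λ ()

  ∈-⁅⁆⁻ : ∀ {u v} → u ∈ₛ ⁅ v ⁆ → u ≡ v
  ∈-⁅⁆⁻ = toWitness

  ∈-⁅⁆⁺ : ∀ {v} → v ∈ₛ ⁅ v ⁆
  ∈-⁅⁆⁺ = fromWitness refl

  ∈-setOf⁻ : ∀ {u P} → u ∈ₛ setOf P → u ∈ P
  ∈-setOf⁻ = toWitness

  ∈-setOf⁺ : ∀ {u P} → u ∈ P → u ∈ₛ setOf P
  ∈-setOf⁺ = fromWitness

  restrict : VertexSet n → (Fin n → ℕ) → Fin n → ℕ
  restrict S f u = if S u then f u else 0

  ∑∈ : VertexSet n → (Fin n → ℕ) → ℕ
  ∑∈ S f = sum (restrict S f)

  syntax ∑∈ S (λ u → e) = ∑[ u ∈ S ] e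

  restrict-∈ : ∀ S f {u} → u ∈ₛ S → restrict S f u ≡ f u
  restrict-∈ S f {u} with S u
  ... | true = λ _ → refl

  restrict-∉ : ∀ S f {u} → u ∉ₛ S → restrict S f u ≡ 0
  restrict-∉ S f {u} with S u
  ... | true  = λ u∉S → ⊥-elim (u∉S tt)
  ... | false = λ _ → refl

  restrict-rel : (R : ℕ → ℕ → Set) → R 0 0 → ∀ S {f g} u → (u ∈ₛ S → R (f u) (g u)) →
                 R (restrict S f u) (restrict S g u)
  restrict-rel R R00 S u fRg with S u
  ... | true  = fRg tt
  ... | false = R00

  module _ (S : VertexSet n) {f g : Fin n → ℕ} where

    ∑-cong : (∀ {u} → u ∈ₛ S → f u ≡ g u) → ∑∈ S f ≡ ∑∈ S g
    ∑-cong f≡g = sum-cong-≗ (λ u → restrict-rel _≡_ refl S {f} {g} u f≡g)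

    ∑-mono-≤ : (∀ {u} → u ∈ₛ S → f u ≤ g u) → ∑∈ S f ≤ ∑∈ S g
    ∑-mono-≤ f≤g = sum-mono-≤ (λ u → restrict-rel _≤_ z≤n S {f} {g} u f≤g)

    ∑-mono-< : (∀ {u} → u ∈ₛ S → f u ≤ g u) → ∀ {v} → v ∈ₛ S → f v < g v → ∑∈ S f < ∑∈ S g
    ∑-mono-< f≤g {v} v∈S fv<gv = sum-mono-< (λ u → restrict-rel _≤_ z≤n S {f} {g} u f≤g) v
      (subst₂ _<_ (sym (restrict-∈ S f v∈S)) (sym (restrict-∈ S g v∈S)) fv<gv)

    ∑-≡⇒≡ : (∀ {u} → u ∈ₛ S → f u ≤ g u) → ∑∈ S f ≡ ∑∈ S g → ∀ {v} → v ∈ₛ S → f v ≡ g v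
    ∑-≡⇒≡ f≤g ∑≡ {v} v∈S with f v ≟ g v
    ... | yes fv≡gv = fv≡gv
    ... | no  fv≢gv = ⊥-elim (<-irrefl ∑≡ (∑-mono-< f≤g v∈S (≤∧≢⇒< (f≤g v∈S) fv≢gv)))

    ∑-distrib-+ : ∑[ u ∈ S ] (f u + g u) ≡ ∑∈ S f + ∑∈ S g
    ∑-distrib-+ = trans (sum-cong-≗ pointwise) (sum-distrib-+ (restrict S f) (restrict S g))
      where
      pointwise : ∀ u → restrict S (λ u → f u + g u) u ≡ restrict S f u + restrict S g u
      pointwise u with S u
      ... | true  = refl
      ... | false = refl

  ∑-zero : ∀ S {f} → (∀ {u} → u ∈ₛ S → f u ≡ 0) → ∑∈ S f ≡ 0
  ∑-zero S {f} f≡0 = sum-zero (λ u → restrict-rel (λ x _ → x ≡ 0) refl S {f} {f} u f≡0)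

  ∑-split : ∀ S C f → ∑∈ S f ≡ ∑∈ (S ∖ C) f + ∑∈ (S ∩ C) f
  ∑-split S C f = trans (sum-cong-≗ pointwise) (sum-distrib-+ (restrict (S ∖ C) f) (restrict (S ∩ C) f))
    where
    pointwise : ∀ u → restrict S f u ≡ restrict (S ∖ C) f u + restrict (S ∩ C) f u
    pointwise u with S u | C u
    ... | false | _     = refl
    ... | true  | true  = refl
    ... | true  | false = sym (+-identityʳ (f u))

  ∑-⁅⁆ : ∀ S f {v} → v ∈ₛ S → ∑∈ (S ∩ ⁅ v ⁆) f ≡ f v
  ∑-⁅⁆ S f {v} v∈S = trans
    (sum-single (restrict (S ∩ ⁅ v ⁆) f) v λ u u≢v →
      restrict-∉ (S ∩ ⁅ v ⁆) f (u≢v ∘ ∈-⁅⁆⁻ ∘ proj₂ ∘ ∈-∩⁻ S ⁅ v ⁆))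
    (restrict-∈ (S ∩ ⁅ v ⁆) f (∈-∩⁺ S ⁅ v ⁆ v∈S ∈-⁅⁆⁺))

  ∑-comm : ∀ S C (f : Fin n → Fin n → ℕ) → ∑[ u ∈ S ] ∑[ w ∈ C ] f u w ≡ ∑[ w ∈ C ] ∑[ u ∈ S ] f u w
  ∑-comm S C f = begin
    sum (restrict S (λ u → sum (restrict C (f u))))                  ≡⟨ sum-cong-≗ (restrict-sum S _) ⟩
    sum (λ u → sum (λ w → restrict S (λ u → restrict C (f u) w) u))
      ≡⟨ sum-comm (λ u w → restrict S (λ u → restrict C (f u) w) u) ⟩
    sum (λ w → sum (λ u → restrict S (λ u → restrict C (f u) w) u))  ≡⟨ sum-cong-≗ (λ w → sum-cong-≗ (swap w)) ⟩
    sum (λ w → sum (λ u → restrict C (λ w → restrict S (λ u → f u w) u) w))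
      ≡⟨ sum-cong-≗ (restrict-sum C _) ⟨
    sum (restrict C (λ w → sum (restrict S (λ u → f u w))))          ∎
    where
    open ≡-Reasoning
    restrict-sum : ∀ S (g : Fin n → Fin n → ℕ) u →
                   restrict S (λ u → sum (g u)) u ≡ sum (λ w → restrict S (λ u → g u w) u)
    restrict-sum S g u with S u
    ... | true  = refl
    ... | false = sym (sum-zero {n} {λ _ → 0} (λ _ → refl))
    swap : ∀ w u → restrict S (λ u → restrict C (f u) w) u ≡ restrict C (λ w → restrict S (λ u → f u w) u) w
    swap w u with S u | C w
    ... | true  | true  = refl
    ... | true  | false = refl
    ... | false | true  = refl
    ... | false | false = refl

  ∑-updateAt-< : ∀ S f {e k} → e ∈ₛ S → k < f e → ∑∈ S (updateAt f e (λ _ → k)) < ∑∈ S f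
  ∑-updateAt-< S f {e} {k} e∈S k<fe =
    ∑-mono-< S lowered e∈S (subst (_< f e) (sym (updateAt-updates e f)) k<fe)
    where
    lowered : ∀ {u} → u ∈ₛ S → updateAt f e (λ _ → k) u ≤ f u
    lowered {u} _ with u Fin.≟ e
    ... | yes refl = subst (_≤ f e) (sym (updateAt-updates e f)) (<⇒≤ k<fe)
    ... | no  u≢e  = ≤-reflexive (updateAt-minimal u e f u≢e)

  ∑-remove : ∀ S f {v} → v ∈ₛ S → ∑∈ S f ≡ ∑∈ (S - v) f + f v
  ∑-remove S f v∈S = trans (∑-split S ⁅ _ ⁆ f) (cong (∑∈ (S - _) f +_) (∑-⁅⁆ S f v∈S))

  size : VertexSet n → ℕ
  size S = ∑[ u ∈ S ] 1

  size-∖-< : ∀ S C {u} → u ∈ₛ S → u ∈ₛ C → size (S ∖ C) < size S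
  size-∖-< S C {u} u∈S u∈C = begin-strict
    size (S ∖ C)                     ≡⟨ +-identityʳ _ ⟨
    size (S ∖ C) + 0                 ≡⟨ cong (size (S ∖ C) +_) (∑-zero (S ∩ C) {λ _ → 0} (λ _ → refl)) ⟨
    size (S ∖ C) + ∑[ w ∈ S ∩ C ] 0  <⟨ +-monoʳ-< (size (S ∖ C)) (∑-mono-< (S ∩ C) (λ _ → z≤n) (∈-∩⁺ S C u∈S u∈C) ≤-refl) ⟩
    size (S ∖ C) + size (S ∩ C)      ≡⟨ ∑-split S C _ ⟨
    size S                           ∎
    where open ≤-Reasoning

  members : VertexSet n → List (Fin n)
  members S = filterᵇ S (allFin n)

  members-unique : ∀ S → Unique (members S)
  members-unique S = Unique.filter⁺ (T? ∘ S) (Unique.allFin⁺ n)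

  ∈-members⁺ : ∀ S {u} → u ∈ₛ S → u ∈ members S
  ∈-members⁺ S {u} = ∈-filter⁺ (T? ∘ S) (∈-allFin u)

  ∈-members⁻ : ∀ S {u} → u ∈ members S → u ∈ₛ S
  ∈-members⁻ S = proj₂ ∘ ∈-filter⁻ (T? ∘ S) {xs = allFin n}

  length-members : ∀ S → length (members S) ≡ size S
  length-members S = length-filterᵇ-tabulate S (λ u → u)

  length≤n : ∀ {xs} → Unique xs → length xs ≤ n
  length≤n {xs} unique = subst (length xs ≤_) (length-tabulate {n = n} (λ u → u))
    (unique⊆⇒length≤ Fin._≟_ {ys = allFin n} unique (λ {u} _ → ∈-allFin u))

module _ {n : ℕ} (G : Graph n) where

  open DecMembership (Fin._≟_ {n}) using (_∈?_)

  -- Degrees and paths in induced subgraphs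

  Adj-sym : ∀ {u w} → Adj G u w → Adj G w u
  Adj-sym {u} {w} = subst T (adj-sym G u w)

  Adj-irrefl : ∀ u → ¬ Adj G u u
  Adj-irrefl u = subst T (adj-irrefl G u)

  Adj? : ∀ u → Decidable (Adj G u)
  Adj? u w = T? (adj G u w)

  deg : VertexSet n → Fin n → ℕ
  deg S u = ∑[ w ∈ S ] 𝟙 (adj G u w)

  degSum : VertexSet n → ℕ
  degSum S = ∑[ u ∈ S ] deg S u

  deg-split : ∀ S C u → deg S u ≡ deg (S ∖ C) u + deg (S ∩ C) u
  deg-split S C u = ∑-split S C (𝟙 ∘ adj G u)

  ∑-deg-comm : ∀ S C → ∑[ u ∈ S ] deg C u ≡ ∑[ w ∈ C ] deg S w
  ∑-deg-comm S C = trans (∑-comm S C (λ u w → 𝟙 (adj G u w)))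
                         (∑-cong C (λ _ → ∑-cong S (λ _ → cong 𝟙 (adj-sym G _ _))))

  degSum-split : ∀ S C → degSum S ≡ degSum (S ∖ C) + ∑[ w ∈ S ∩ C ] (deg (S ∖ C) w + deg S w)
  degSum-split S C = begin
    degSum S
      ≡⟨ ∑-split S C (deg S) ⟩
    ∑[ u ∈ S ∖ C ] deg S u + R
      ≡⟨ cong (_+ R) (∑-cong (S ∖ C) (λ {u} _ → deg-split S C u)) ⟩
    ∑[ u ∈ S ∖ C ] (deg (S ∖ C) u + deg (S ∩ C) u) + R
      ≡⟨ cong (_+ R) (∑-distrib-+ (S ∖ C)) ⟩
    degSum (S ∖ C) + ∑[ u ∈ S ∖ C ] deg (S ∩ C) u + R
      ≡⟨ cong (λ x → degSum (S ∖ C) + x + R) (∑-deg-comm (S ∖ C) (S ∩ C)) ⟩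
    degSum (S ∖ C) + ∑[ w ∈ S ∩ C ] deg (S ∖ C) w + R
      ≡⟨ +-assoc (degSum (S ∖ C)) _ R ⟩
    degSum (S ∖ C) + (∑[ w ∈ S ∩ C ] deg (S ∖ C) w + R)
      ≡⟨ cong (degSum (S ∖ C) +_) (∑-distrib-+ (S ∩ C)) ⟨
    degSum (S ∖ C) + ∑[ w ∈ S ∩ C ] (deg (S ∖ C) w + deg S w)
      ∎
    where
    open ≡-Reasoning
    R = ∑[ w ∈ S ∩ C ] deg S w

  deg-remove-self : ∀ S {v} → v ∈ₛ S → deg (S - v) v ≡ deg S v
  deg-remove-self S {v} v∈S = begin
    deg (S - v) v                           ≡⟨ +-identityʳ _ ⟨
    deg (S - v) v + 0                       ≡⟨ cong (λ b → deg (S - v) v + 𝟙 b) (adj-irrefl G v) ⟨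
    deg (S - v) v + 𝟙 (adj G v v)           ≡⟨ cong (deg (S - v) v +_) (∑-⁅⁆ S (𝟙 ∘ adj G v) v∈S) ⟨
    deg (S - v) v + deg (S ∩ ⁅ v ⁆) v       ≡⟨ deg-split S ⁅ v ⁆ v ⟨
    deg S v                                 ∎
    where open ≡-Reasoning

  degSum-remove : ∀ S {v} → v ∈ₛ S → degSum S ≡ degSum (S - v) + 2 * deg S v
  degSum-remove S {v} v∈S = begin
    degSum S
      ≡⟨ degSum-split S ⁅ v ⁆ ⟩
    degSum (S - v) + ∑[ w ∈ S ∩ ⁅ v ⁆ ] (deg (S - v) w + deg S w)
      ≡⟨ cong (degSum (S - v) +_) (∑-⁅⁆ S _ v∈S) ⟩
    degSum (S - v) + (deg (S - v) v + deg S v)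
      ≡⟨ cong (λ d → degSum (S - v) + (d + deg S v)) (deg-remove-self S v∈S) ⟩
    degSum (S - v) + (deg S v + deg S v)
      ≡⟨ cong (λ d → degSum (S - v) + (deg S v + d)) (+-identityʳ _) ⟨
    degSum (S - v) + 2 * deg S v
      ∎
    where open ≡-Reasoning

  neighbours : VertexSet n → Fin n → List (Fin n)
  neighbours S u = members (S ∩ adj G u)

  deg≡length-neighbours : ∀ S u → deg S u ≡ length (neighbours S u)
  deg≡length-neighbours S u = trans (sum-cong-≗ pointwise) (sym (length-members (S ∩ adj G u)))
    where
    pointwise : ∀ w → restrict S (𝟙 ∘ adj G u) w ≡ restrict (S ∩ adj G u) (λ _ → 1) w
    pointwise w with S w
    ... | true  = refl
    ... | false = refl

  ∈-neighbours⁺ : ∀ S {u w} → w ∈ₛ S → Adj G u w → w ∈ neighbours S u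
  ∈-neighbours⁺ S {u} w∈S u∼w = ∈-members⁺ (S ∩ adj G u) (∈-∩⁺ S (adj G u) w∈S u∼w)

  ∈-neighbours⁻ : ∀ S {u w} → w ∈ neighbours S u → w ∈ₛ S × Adj G u w
  ∈-neighbours⁻ S {u} = ∈-∩⁻ S (adj G u) ∘ ∈-members⁻ (S ∩ adj G u)

  Path : VertexSet n → List (Fin n) → Set
  Path S xs = IsPath G xs × All (_∈ₛ S) xs

  PathBound : VertexSet n → (Fin n → ℕ) → Set
  PathBound S p = ∀ {u xs} → Path S xs → u ∈ xs → length xs ≤ suc (p u)

  NeighboursIn : VertexSet n → Fin n → List (Fin n) → Set
  NeighboursIn S u P = ∀ {w} → w ∈ₛ S → Adj G u w → w ∈ P

  Closed : VertexSet n → List (Fin n) → Set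
  Closed S P = ∀ {u} → u ∈ P → NeighboursIn S u P

  IsCluster : VertexSet n → Set
  IsCluster S = ∀ {a b c} → a ∈ₛ S → b ∈ₛ S → c ∈ₛ S → Adj G a b → Adj G b c → a ≢ c → Adj G a c

  singleton-path : ∀ {S u} → u ∈ₛ S → Path S [ u ]
  singleton-path u∈S = (([] ∷ []) , [-]) , u∈S ∷ []

  Path-tail : ∀ {S x xs} → Path S (x ∷ xs) → Path S xs
  Path-tail ((_ ∷ unique , linked) , _ ∷ inS) = (unique , Linked.tail linked) , inS

  PathBound-⊆ : ∀ {S S′ p} → (∀ {u} → u ∈ₛ S′ → u ∈ₛ S) → PathBound S p → PathBound S′ p
  PathBound-⊆ S′⊆S bound (isPath , inS′) = bound (isPath , All.map S′⊆S inS′)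

  Path-↭ : ∀ {S P Q w} → Path S P → w ∈ₛ S → w ∉ P → Q ↭ w ∷ P → Linked (Adj G) Q → Path S Q
  Path-↭ ((unique , _) , inS) w∈S w∉P Q↭wP linked =
    (Perm.Unique-resp-↭ (setoid _) (↭⇒↭ₛ (↭-sym Q↭wP)) (w≢P ∷ unique) , linked) , All-resp-↭ (↭-sym Q↭wP) (w∈S ∷ inS)
    where
    w≢P = All.tabulate λ u∈P w≡u → w∉P (subst (_∈ _) (sym w≡u) u∈P)

  cluster-path-head : ∀ {S x xs w} → IsCluster S → Path S (x ∷ xs) → w ∈ xs → Adj G x w
  cluster-path-head cluster ((_ , x∼y ∷ _) , _) (here refl) = x∼y
  cluster-path-head cluster path@(((x∉ ∷ _) , x∼y ∷ _) , x∈S ∷ y∈S ∷ _) (there w∈) =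
    cluster x∈S y∈S (All.lookup (proj₂ path) (there (there w∈))) x∼y
      (cluster-path-head cluster (Path-tail path) w∈) (All.lookup x∉ (there w∈))

  cluster-path-clique : ∀ {S xs u w} → IsCluster S → Path S xs → u ∈ xs → w ∈ xs → u ≢ w → Adj G u w
  cluster-path-clique cluster path (here refl) (here refl) u≢w = contradiction refl u≢w
  cluster-path-clique cluster path (here refl) (there w∈) _ = cluster-path-head cluster path w∈
  cluster-path-clique cluster path (there u∈) (here refl) _ = Adj-sym (cluster-path-head cluster path u∈)
  cluster-path-clique cluster path (there u∈) (there w∈) u≢w = cluster-path-clique cluster (Path-tail path) u∈ w∈ u≢w

  degSum-remove-closed : ∀ S {P} → Closed S P → degSum S ≡ degSum (S ∖ setOf P) + ∑[ u ∈ S ∩ setOf P ] deg S u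
  degSum-remove-closed S {P} closed = trans (degSum-split S (setOf P))
    (cong (degSum (S ∖ setOf P) +_) (∑-cong (S ∩ setOf P) λ u∈ →
      cong (_+ _) (∑-zero (S ∖ setOf P) λ w∈ → 𝟙-false (no-edge-out u∈ w∈))))
    where
    no-edge-out : ∀ {u w} → u ∈ₛ S ∩ setOf P → w ∈ₛ S ∖ setOf P → ¬ Adj G u w
    no-edge-out u∈ w∈ u∼w = let w∈S , w∉P = ∈-∖⁻ S (setOf P) w∈ in
      w∉P (∈-setOf⁺ (closed (∈-setOf⁻ (proj₂ (∈-∩⁻ S (setOf P) u∈))) w∈S u∼w))

  deg-bound : ∀ S {u P xs} → NeighboursIn S u P → Unique xs → xs ⊆ P → All (λ w → ¬ Adj G u w) xs →
              length xs + deg S u ≤ length P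
  deg-bound S {u} {P} {xs} closed unique xs⊆P non-adjacent = begin
    length xs + deg S u                        ≡⟨ cong (length xs +_) (deg≡length-neighbours S u) ⟩
    length xs + length (neighbours S u)        ≡⟨ length-++ xs ⟨
    length (xs ++ neighbours S u)              ≤⟨ unique⊆⇒length≤ Fin._≟_ (Unique.++⁺ unique (members-unique _) disjoint) ⊆P ⟩
    length P                                   ∎
    where
    open ≤-Reasoning
    disjoint : ∀ {w} → ¬ (w ∈ xs × w ∈ neighbours S u)
    disjoint (w∈xs , w∈N) = All.lookup non-adjacent w∈xs (proj₂ (∈-neighbours⁻ S w∈N))
    ⊆P : xs ++ neighbours S u ⊆ P
    ⊆P w∈ with ∈-++⁻ xs w∈
    ... | inj₁ w∈xs = xs⊆P w∈xs
    ... | inj₂ w∈N  = let w∈S , u∼w = ∈-neighbours⁻ S w∈N in closed w∈S u∼w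

  deg≤count : ∀ S {u P} → NeighboursIn S u P → deg S u ≤ length (filter (Adj? u) P)
  deg≤count S {u} closed = subst (_≤ _) (sym (deg≡length-neighbours S u))
    (unique⊆⇒length≤ Fin._≟_ (members-unique _) λ w∈N →
      let w∈S , u∼w = ∈-neighbours⁻ S w∈N in ∈-filter⁺ (Adj? u) (closed w∈S u∼w) u∼w)

  -- Ore's argument: the ends x and z have ≥ |P| neighbours in total, all on P, so by pigeonhole
  -- some consecutive pair m b of P has z ∼ m and x ∼ b.
  ore-cycle : ∀ {S x ys} → Path S (x ∷ ys) → NeighboursIn S x (x ∷ ys) → NeighboursIn S (lastOf x ys) (x ∷ ys) →
              length (x ∷ ys) ≤ deg S x + deg S (lastOf x ys) →
              ∃₂ λ h t → Linked (Adj G) (h ∷ t) × Adj G (lastOf h t) h × h ∷ t ↭ x ∷ ys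
  ore-cycle {S} {x} {ys} ((_ , linked) , _) x-closed z-closed long
    with crossing (Adj? x) (Adj? (lastOf x ys)) x ys (Adj-irrefl (lastOf x ys))
  ... | inj₁ (ms , b , bs , refl , z∼m , x∼b) =
    crossing⇒cycle Adj-sym linked x∼b (subst (Adj G (lastOf x ms)) (lastOf-++ x ms b bs) (Adj-sym z∼m))
  ... | inj₂ counted = contradiction long (<⇒≱ (begin-strict
    deg S x + deg S z                                ≤⟨ +-mono-≤ (deg≤count S x-closed) (deg≤count S z-closed) ⟩
    length (filter (Adj? x) (x ∷ ys)) + N[z]         ≡⟨ cong (λ l → length l + N[z]) (filter-reject (Adj? x) (Adj-irrefl x)) ⟩
    length (filter (Adj? x) ys) + N[z]               ≤⟨ counted ⟩
    length ys                                        <⟨ ≤-refl ⟩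
    length (x ∷ ys)                                  ∎))
    where
    open ≤-Reasoning
    z = lastOf x ys
    N[z] = length (filter (Adj? z) (x ∷ ys))

  -- Growing a path

  Exit : VertexSet n → List (Fin n) → Fin n → Set
  Exit S P u = ∃ λ w → w ∈ₛ S × Adj G u w × w ∉ P

  exit? : ∀ S P → Decidable (Exit S P)
  exit? S P u = Fin.any? (λ w → T? (S w) ×-dec Adj? u w ×-dec ¬? (w ∈? P))

  no-exit⇒NeighboursIn : ∀ {S P u} → ¬ Exit S P u → NeighboursIn S u P
  no-exit⇒NeighboursIn {P = P} no-exit {w} w∈S u∼w with w ∈? P
  ... | yes w∈P = w∈P
  ... | no  w∉P = contradiction (w , w∈S , u∼w , w∉P) no-exit

  Longer : VertexSet n → List (Fin n) → Set
  Longer S P = ∃₂ λ y ys → Path S (y ∷ ys) × length (y ∷ ys) ≡ suc (length P)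

  longer : ∀ {S P y ys w} → Path S P → w ∈ₛ S → w ∉ P → y ∷ ys ↭ w ∷ P → Linked (Adj G) (y ∷ ys) →
           Longer S P
  longer path w∈S w∉P perm linked = _ , _ , Path-↭ path w∈S w∉P perm linked , ↭-length perm

  data Reduction (S : VertexSet n) (p : Fin n → ℕ) : Set where
    closed-path : ∀ {x ys} → Path S (x ∷ ys) → Closed S (x ∷ ys) → Reduction S p
    low-vertex  : ∀ {P v e} → Path S P → v ∈ P → e ∈ P → v ≢ e → NeighboursIn S e P →
                  2 * deg S v ≤ p v → Reduction S p

  module _ {S : VertexSet n} {p : Fin n → ℕ} (bound : PathBound S p) where

    high-ends⇒ore : ∀ {x ys} → Path S (x ∷ ys) →
                    ¬ (2 * deg S x ≤ p x) → ¬ (2 * deg S (lastOf x ys) ≤ p (lastOf x ys)) →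
                    length (x ∷ ys) ≤ deg S x + deg S (lastOf x ys)
    high-ends⇒ore {x} {ys} path high-x high-z =
      m≤2a∧m≤2b⇒m≤a+b {a = deg S x} (length≤2deg (here refl) high-x) (length≤2deg (lastOf-∈ x ys) high-z)
      where
      length≤2deg : ∀ {u} → u ∈ x ∷ ys → ¬ (2 * deg S u ≤ p u) → length (x ∷ ys) ≤ 2 * deg S u
      length≤2deg u∈P high = ≤-trans (bound path u∈P) (≰⇒> high)

    closed-ends : ∀ {x ys} → Path S (x ∷ ys) → NeighboursIn S x (x ∷ ys) → NeighboursIn S (lastOf x ys) (x ∷ ys) →
                  Reduction S p ⊎ Longer S (x ∷ ys)
    closed-ends {x} {[]} path x-closed _ = inj₁ (closed-path path λ { (here refl) → x-closed })
    closed-ends {x} {ys@(y ∷ ys′)} path x-closed z-closed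
      with any? (exit? S (x ∷ ys)) (x ∷ ys) | 2 * deg S x ≤? p x | 2 * deg S (lastOf x ys) ≤? p (lastOf x ys)
    ... | no no-exit | _ | _ =
      inj₁ (closed-path path (λ u∈P → no-exit⇒NeighboursIn (no-exit ∘ lose u∈P)))
    ... | yes _ | yes low | _ =
      inj₁ (low-vertex path (here refl) (lastOf-∈ x ys) (head≢lastOf (proj₁ (proj₁ path))) z-closed low)
    ... | yes _ | no _ | yes low =
      inj₁ (low-vertex path (lastOf-∈ x ys) (here refl) (head≢lastOf (proj₁ (proj₁ path)) ∘ sym) x-closed low)
    ... | yes some-exit | no high-x | no high-z
      with find some-exit | ore-cycle path x-closed z-closed (high-ends⇒ore path high-x high-z)
    ... | c , c∈P , w , w∈S , c∼w , w∉P | h , t , linked , closing , h∷t↭P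
      with cycle-rotate linked closing (∈-resp-↭ (↭-sym h∷t↭P) c∈P)
    ... | r , linked′ , c∷r↭h∷t =
      inj₂ (longer path w∈S w∉P (prep w (↭-trans c∷r↭h∷t h∷t↭P)) (Adj-sym c∼w ∷ linked′))

    grow-or-reduce : ∀ {x ys} → Path S (x ∷ ys) → Reduction S p ⊎ Longer S (x ∷ ys)
    grow-or-reduce {x} {ys} path@((_ , linked) , _)
      with exit? S (x ∷ ys) x | exit? S (x ∷ ys) (lastOf x ys)
    ... | yes (w , w∈S , x∼w , w∉P) | _ =
      inj₂ (longer path w∈S w∉P ↭-refl (Adj-sym x∼w ∷ linked))
    ... | no _ | yes (w , w∈S , z∼w , w∉P) =
      inj₂ (longer path w∈S w∉P (↭-sym (∷↭∷ʳ w (x ∷ ys))) (Linked-join linked z∼w [-]))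
    ... | no x-closed | no z-closed =
      closed-ends path (no-exit⇒NeighboursIn x-closed) (no-exit⇒NeighboursIn z-closed)

    explore : ∀ k {x ys} → Path S (x ∷ ys) → n < length (x ∷ ys) + k → Reduction S p
    explore zero    path n< =
      contradiction (length≤n (proj₁ (proj₁ path))) (<⇒≱ (subst (n <_) (+-identityʳ _) n<))
    explore (suc k) path n< with grow-or-reduce path
    ... | inj₁ reduction               = reduction
    ... | inj₂ (_ , _ , path′ , grown) =
      explore k path′ (subst (n <_) (trans (+-suc _ k) (cong (_+ k) (sym grown))) n<)

  -- Induction on the vertex set

  EdgeBound : VertexSet n → (Fin n → ℕ) → Set
  EdgeBound S p = degSum S ≤ ∑∈ S p × (degSum S ≡ ∑∈ S p → IsCluster S)

  EdgeBound-∅ : ∀ {S p} → (∀ u → u ∉ₛ S) → EdgeBound S p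
  EdgeBound-∅ {S} empty =
    subst (_≤ _) (sym (∑-zero S (λ {u} u∈S → contradiction u∈S (empty u)))) z≤n ,
    λ _ {a} a∈S → contradiction a∈S (empty a)

  closed⇒deg< : ∀ {S P u} → Closed S P → u ∈ P → deg S u < length P
  closed⇒deg< {S} {u = u} closed u∈P =
    deg-bound S (closed u∈P) ([] ∷ []) (λ { (here refl) → u∈P }) (Adj-irrefl u ∷ [])

  closed∧maxdeg⇒clique : ∀ {S P} → Closed S P → (∀ {u} → u ∈ P → length P ≤ suc (deg S u)) →
                         ∀ {u w} → u ∈ P → w ∈ P → u ≢ w → Adj G u w
  closed∧maxdeg⇒clique {S} closed maxdeg {u} {w} u∈P w∈P u≢w with Adj? u w
  ... | yes u∼w = u∼w
  ... | no  u≁w = contradiction (maxdeg u∈P)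
    (<⇒≱ (deg-bound S (closed u∈P) (((u≢w ∘ sym) ∷ []) ∷ [] ∷ [])
                    (λ { (here refl) → w∈P ; (there (here refl)) → u∈P }) (u≁w ∷ Adj-irrefl u ∷ [])))

  IsCluster-closed : ∀ {S P} → Closed S P → (∀ {u w} → u ∈ P → w ∈ P → u ≢ w → Adj G u w) →
                     IsCluster (S ∖ setOf P) → IsCluster S
  IsCluster-closed {S} {P} closed clique cluster′ {a} {b} {c} a∈S b∈S c∈S a∼b b∼c a≢c with b ∈? P
  ... | yes b∈P = clique (closed b∈P a∈S (Adj-sym a∼b)) (closed b∈P c∈S b∼c) a≢c
  ... | no  b∉P = cluster′ (outside a∈S (λ a∈P → b∉P (closed a∈P b∈S a∼b))) (outside b∈S b∉P)
                           (outside c∈S (λ c∈P → b∉P (closed c∈P b∈S (Adj-sym b∼c)))) a∼b b∼c a≢c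
    where
    outside : ∀ {u} → u ∈ₛ S → u ∉ P → u ∈ₛ S ∖ setOf P
    outside u∈S u∉P = ∈-∖⁺ S (setOf P) u∈S (u∉P ∘ ∈-setOf⁻)

  remove-closed-step : ∀ {S P p} → Path S P → Closed S P → PathBound S p → EdgeBound (S ∖ setOf P) p →
                       EdgeBound S p
  remove-closed-step {S} {P} {p} path closed bound (≤′ , tight′) = ≤-whole , tight
    where
    inP : ∀ {u} → u ∈ₛ S ∩ setOf P → u ∈ P
    inP = ∈-setOf⁻ ∘ proj₂ ∘ ∈-∩⁻ S (setOf P)
    deg≤p : ∀ {u} → u ∈ₛ S ∩ setOf P → deg S u ≤ p u
    deg≤p u∈ = s≤s⁻¹ (≤-trans (closed⇒deg< closed (inP u∈)) (bound path (inP u∈)))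
    degSum≡ = degSum-remove-closed S closed
    ∑p≡ = ∑-split S (setOf P) p
    ≤-whole : degSum S ≤ ∑∈ S p
    ≤-whole = subst₂ _≤_ (sym degSum≡) (sym ∑p≡) (+-mono-≤ ≤′ (∑-mono-≤ (S ∩ setOf P) deg≤p))
    tight : degSum S ≡ ∑∈ S p → IsCluster S
    tight eq = IsCluster-closed closed (closed∧maxdeg⇒clique closed maxdeg) (tight′ (proj₁ split))
      where
      split = ≤+≤-≡⇒≡ ≤′ (∑-mono-≤ (S ∩ setOf P) deg≤p) (trans (sym degSum≡) (trans eq ∑p≡))
      maxdeg : ∀ {u} → u ∈ P → length P ≤ suc (deg S u)
      maxdeg u∈P = subst (λ d → length P ≤ suc d) (sym (∑-≡⇒≡ (S ∩ setOf P) deg≤p (proj₂ split) u∈S∩P))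
                         (bound path u∈P)
        where u∈S∩P = ∈-∩⁺ S (setOf P) (All.lookup (proj₂ path) u∈P) (∈-setOf⁺ u∈P)

  PathBound-updateAt : ∀ {S p e k} → PathBound S p → (∀ {Q} → Path S Q → e ∈ Q → length Q ≤ suc k) →
                       PathBound S (updateAt p e (λ _ → k))
  PathBound-updateAt {p = p} {e} bound bound-e {u} {Q} path u∈Q with u Fin.≟ e
  ... | yes refl = subst (λ x → length Q ≤ suc x) (sym (updateAt-updates e p)) (bound-e path u∈Q)
  ... | no  u≢e  = subst (λ x → length Q ≤ suc x) (sym (updateAt-minimal u e p u≢e)) (bound path u∈Q)

  -- Tightness makes p the least path bound at e: as [e] is a path, m = k + 2, and lowering p e
  -- to k < p e would give a bound q with ∑ q < ∑ p = degSum S ≤ ∑ q.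
  tight⇒least : ∀ {S p e m} → (∀ q → PathBound S q → degSum S ≤ ∑∈ S q) → degSum S ≡ ∑∈ S p →
                PathBound S p → e ∈ₛ S → (∀ {Q} → Path S Q → e ∈ Q → length Q < m) → suc (p e) < m
  tight⇒least {S} {p} {e} ≤-all tight bound e∈S short with short (singleton-path e∈S) (here refl)
  ... | s≤s (s≤s {n = k} _) = s≤s (s≤s (≮⇒≥ λ k<pe →
    <-irrefl tight (≤-<-trans (≤-all _ (PathBound-updateAt bound (λ path e∈Q → s≤s⁻¹ (short path e∈Q))))
                              (∑-updateAt-< S p e∈S k<pe))))

  cluster-path-length< : ∀ {S P Q v e} → IsCluster (S - v) → v ∈ P → e ∈ P → NeighboursIn S e P →
                         Path (S - v) Q → e ∈ Q → length Q < length P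
  cluster-path-length< {S} {P} {Q} {v} {e} cluster′ v∈P e∈P e-closed pathQ e∈Q =
    unique⊆⇒length≤ Fin._≟_ (v∉Q ∷ proj₁ (proj₁ pathQ)) vQ⊆P
    where
    v∉Q : All (v ≢_) Q
    v∉Q = All.map (λ w∈S-v v≡w → proj₂ (∈-∖⁻ S ⁅ v ⁆ w∈S-v) (subst (_∈ₛ ⁅ v ⁆) v≡w ∈-⁅⁆⁺)) (proj₂ pathQ)
    vQ⊆P : v ∷ Q ⊆ P
    vQ⊆P (here refl) = v∈P
    vQ⊆P {w} (there w∈Q) with w Fin.≟ e
    ... | yes refl = e∈P
    ... | no  w≢e  = e-closed (proj₁ (∈-∖⁻ S ⁅ v ⁆ (All.lookup (proj₂ pathQ) w∈Q)))
                              (cluster-path-clique cluster′ pathQ e∈Q w∈Q (w≢e ∘ sym))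

  remove-vertex-step : ∀ {S P p v e} → Path S P → v ∈ P → e ∈ P → v ≢ e → NeighboursIn S e P →
                       2 * deg S v ≤ p v → PathBound S p →
                       (∀ q → PathBound (S - v) q → EdgeBound (S - v) q) → EdgeBound S p
  remove-vertex-step {S} {P} {p} {v} {e} path v∈P e∈P v≢e e-closed low bound edge-bound′ = ≤-whole , tight
    where
    bound′ : PathBound (S - v) p
    bound′ = PathBound-⊆ (proj₁ ∘ ∈-∖⁻ S ⁅ v ⁆) bound
    degSum≡ = degSum-remove S (All.lookup (proj₂ path) v∈P)
    ∑p≡ = ∑-remove S p (All.lookup (proj₂ path) v∈P)
    ≤-whole : degSum S ≤ ∑∈ S p
    ≤-whole = subst₂ _≤_ (sym degSum≡) (sym ∑p≡) (+-mono-≤ (proj₁ (edge-bound′ p bound′)) low)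
    -- In the tight case S - v is a cluster graph, so the paths of S - v through e lie in P - v
    -- and p e ≥ |P| - 1 is not the least bound at e.
    tight : degSum S ≡ ∑∈ S p → IsCluster S
    tight eq = contradiction (bound path e∈P)
      (<⇒≱ (tight⇒least (λ q → proj₁ ∘ edge-bound′ q) tight′ bound′ e∈S-v
              (cluster-path-length< (proj₂ (edge-bound′ p bound′) tight′) v∈P e∈P e-closed)))
      where
      tight′ : degSum (S - v) ≡ ∑∈ (S - v) p
      tight′ = proj₁ (≤+≤-≡⇒≡ (proj₁ (edge-bound′ p bound′)) low (trans (sym degSum≡) (trans eq ∑p≡)))
      e∈S-v : e ∈ₛ S - v
      e∈S-v = ∈-∖⁺ S ⁅ v ⁆ (All.lookup (proj₂ path) e∈P) (v≢e ∘ sym ∘ ∈-⁅⁆⁻)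

  reduce : ∀ {S p} → PathBound S p →
           (∀ C {u} → u ∈ₛ S → u ∈ₛ C → ∀ q → PathBound (S ∖ C) q → EdgeBound (S ∖ C) q) →
           Reduction S p → EdgeBound S p
  reduce {S} {p} bound recurse (closed-path {x} {ys} path closed) =
    remove-closed-step path closed bound
      (recurse (setOf (x ∷ ys)) (All.lookup (proj₂ path) (here refl)) (∈-setOf⁺ (here refl)) p
               (PathBound-⊆ (proj₁ ∘ ∈-∖⁻ S (setOf (x ∷ ys))) bound))
  reduce bound recurse (low-vertex path v∈P e∈P v≢e e-closed low) =
    remove-vertex-step path v∈P e∈P v≢e e-closed low bound (recurse ⁅ _ ⁆ (All.lookup (proj₂ path) v∈P) ∈-⁅⁆⁺)

  edge-bound : ∀ k S p → size S ≤ k → PathBound S p → EdgeBound S p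
  edge-bound zero S p size≤0 bound =
    EdgeBound-∅ (λ u u∈S → contradiction size≤0 (<⇒≱ (≤-<-trans z≤n (size-∖-< S S u∈S u∈S))))
  edge-bound (suc k) S p size≤ bound with Fin.any? (λ v → T? (S v))
  ... | no  ∄v        = EdgeBound-∅ (λ u u∈S → ∄v (u , u∈S))
  ... | yes (v , v∈S) = reduce bound recurse (explore bound n (singleton-path v∈S) (n<1+n n))
    where
    recurse : ∀ C {u} → u ∈ₛ S → u ∈ₛ C → ∀ q → PathBound (S ∖ C) q → EdgeBound (S ∖ C) q
    recurse C u∈S u∈C q = edge-bound k (S ∖ C) q (s≤s⁻¹ (<-≤-trans (size-∖-< S C u∈S u∈C) size≤))

  -- The whole graph

  𝟙-adj-split : ∀ i j → 𝟙 (adj G i j) ≡ 𝟙 ((toℕ i <ᵇ toℕ j) ∧ adj G i j) + 𝟙 ((toℕ j <ᵇ toℕ i) ∧ adj G i j)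
  𝟙-adj-split i j
    with toℕ i <ᵇ toℕ j | <ᵇ-reflects-< (toℕ i) (toℕ j) | toℕ j <ᵇ toℕ i | <ᵇ-reflects-< (toℕ j) (toℕ i)
  ... | true  | ofʸ i<j | true  | ofʸ j<i = contradiction j<i (<⇒≯ i<j)
  ... | true  | _       | false | _       = sym (+-identityʳ _)
  ... | false | _       | true  | _       = refl
  ... | false | ofⁿ i≮j | false | ofⁿ j≮i with Fin.toℕ-injective (≤∧≮⇒≡ (≮⇒≥ j≮i) i≮j)
  ...   | refl = cong 𝟙 (adj-irrefl G i)

  degSum-all : degSum all ≡ 2 * edgeCount G
  degSum-all = begin
    sum (λ i → sum (λ j → 𝟙 (adj G i j)))          ≡⟨ sum-cong-≗ (λ i → sum-cong-≗ (𝟙-adj-split i)) ⟩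
    sum (λ i → sum (λ j → forward i j + backward i j)) ≡⟨ sum-cong-≗ (λ i → sum-distrib-+ (forward i) (backward i)) ⟩
    sum (λ i → sum (forward i) + sum (backward i))   ≡⟨ sum-distrib-+ (sum ∘ forward) (sum ∘ backward) ⟩
    E + sum (λ i → sum (backward i))                 ≡⟨ cong (E +_) (sum-comm backward) ⟩
    E + sum (λ j → sum (λ i → backward i j))         ≡⟨ cong (E +_) (sum-cong-≗ λ j → sum-cong-≗ λ i →
                                                          cong (λ b → 𝟙 (lt j i ∧ b)) (adj-sym G i j)) ⟩
    E + E                                            ≡⟨ cong (E +_) (+-identityʳ E) ⟨
    2 * E                                            ≡⟨ cong (2 *_) edgeCount≡E ⟨
    2 * edgeCount G                                  ∎
    where
    open ≡-Reasoning
    lt : Fin n → Fin n → Bool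
    lt i j = toℕ i <ᵇ toℕ j
    forward backward : Fin n → Fin n → ℕ
    forward  i j = 𝟙 (lt i j ∧ adj G i j)
    backward i j = 𝟙 (lt j i ∧ adj G i j)
    E = sum (λ i → sum (forward i))
    edgeCount≡E : edgeCount G ≡ E
    edgeCount≡E = trans (sumFin≡sum (λ i → sumFin (forward i))) (sum-cong-≗ (λ i → sumFin≡sum (forward i)))

  cluster⇒cliques : IsCluster all → ComponentsAreCliques G
  cluster⇒cliques cluster u v here          u≢v = contradiction refl u≢v
  cluster⇒cliques cluster u v (step {v = w} u∼w w⇝v) u≢v with w Fin.≟ v
  ... | yes refl = u∼w
  ... | no  w≢v  = cluster tt tt tt u∼w (cluster⇒cliques cluster w v w⇝v w≢v) u≢v

  cliques⇒cluster : ComponentsAreCliques G → IsCluster all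
  cliques⇒cluster cliques _ _ _ a∼b b∼c a≢c = cliques _ _ (step a∼b (step b∼c here)) a≢c

  cluster⇒length≤ : ∀ {S xs v} → IsCluster S → Path S xs → v ∈ xs → length xs ≤ suc (deg S v)
  cluster⇒length≤ {S} {xs} {v} cluster path v∈xs =
    subst (length xs ≤_) (cong suc (sym (deg≡length-neighbours S v)))
      (unique⊆⇒length≤ Fin._≟_ (proj₁ (proj₁ path)) xs⊆N[v])
    where
    xs⊆N[v] : xs ⊆ v ∷ neighbours S v
    xs⊆N[v] {w} w∈xs with w Fin.≟ v
    ... | yes refl = here refl
    ... | no  w≢v  = there (∈-neighbours⁺ S (All.lookup (proj₂ path) w∈xs)
                                            (cluster-path-clique cluster path v∈xs w∈xs (w≢v ∘ sym)))

theorem2p1 : (n : ℕ) (G : Graph n) (p : Fin n → ℕ) →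
    (∀ v → IsMaxPathLen G v (p v)) →
    (2 * edgeCount G ≤ sumFin p)
      × ((2 * edgeCount G ≡ sumFin p) ⇔ ComponentsAreCliques G)
theorem2p1 n G p maxPath = ≤-edges , mk⇔ tight⇒cliques cliques⇒tight
  where
  bound : PathBound G all p
  bound (isPath , _) u∈xs = proj₂ (maxPath _) _ isPath u∈xs
  edge-bound-all : EdgeBound G all p
  edge-bound-all = edge-bound G (size {n} all) all p ≤-refl bound
  2E≡ : degSum G all ≡ 2 * edgeCount G
  2E≡ = degSum-all G
  ∑p≡ : ∑∈ all p ≡ sumFin p
  ∑p≡ = sym (sumFin≡sum p)
  ≤-edges : 2 * edgeCount G ≤ sumFin p
  ≤-edges = subst₂ _≤_ 2E≡ ∑p≡ (proj₁ edge-bound-all)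
  tight⇒cliques : 2 * edgeCount G ≡ sumFin p → ComponentsAreCliques G
  tight⇒cliques eq = cluster⇒cliques G (proj₂ edge-bound-all (trans 2E≡ (trans eq (sym ∑p≡))))
  cliques⇒tight : ComponentsAreCliques G → 2 * edgeCount G ≡ sumFin p
  cliques⇒tight cliques = ≤-antisym ≤-edges (subst₂ _≤_ ∑p≡ 2E≡ (sum-mono-≤ p≤deg))
    where
    p≤deg : ∀ v → p v ≤ deg G all v
    p≤deg v with proj₁ (maxPath v)
    ... | xs , isPath , v∈xs , |xs|≡ = s≤s⁻¹ (subst (_≤ _) |xs|≡
      (cluster⇒length≤ G (cliques⇒cluster G cliques) (isPath , All.tabulate (λ _ → tt)) v∈xs))
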